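{- For every integer $n\geq 13$, there exists a simple connected graph on $n$ vertices which is not a tree and which is neutral, i.e. whose assortativity coefficient satisfies $r=0$.
   Context: For a simple connected graph $G=(V,E)$ with $m=|E|\geq 1$ edges, where $d_u$ is the degree of vertex $u$ and $e_{uv}$ denotes the edge with endpoints $u,v$, the assortativity coefficient is $$r=\frac{m^{ -1}\sum_{e_{uv}\in E} d_{u}d_{v}-\Big[m^{ -1}\sum_{e_{uv}\in E} \tfrac{1}{2}(d_{u}+d_{v})\Big]^{2}}{m^{ -1}\sum_{e_{uv}\in E} \tfrac{1}{2}(d^{2}_{u}+d^{2}_{v})-\Big[m^{ -1}\sum_{e_{uv}\in E} \tfrac{1}{2}(d_{u}+d_{v})\Big]^{2}}.$$ $G$ is called neutral if $r$ is well defined (nonzero denominator) and $r=0$. -}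

module Defs where

open import Data.Bool using (Bool; true; false; if_then_else_)
open import Data.Nat as ℕ using (ℕ; _≤_)
open import Data.Fin using (Fin; _<_)
open import Data.Fin.Properties using (_<?_)
open import Data.List using (List; []; _∷_; length; map; concatMap; foldr; last)
open import Data.List.Relation.Unary.Unique.Propositional using (Unique)
open import Data.Maybe using (Maybe; just; nothing)
open import Data.Product using (Σ; _×_; _,_)
open import Data.Unit using (⊤)
open import Data.Empty using (⊥)
open import Data.Integer using (+_)
open import Data.Rational as ℚ using (ℚ; 0ℚ; _÷_)
open import Relation.Binary.PropositionalEquality using (_≡_)
open import Relation.Nullary using (¬_; yes; no)

record Graph (n : ℕ) : Set where
  field
    adj    : Fin n → Fin n → Bool
    sym    : ∀ u v → adj u v ≡ adj v u
    irrefl : ∀ u → adj u u ≡ false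
open Graph public

module _ {n : ℕ} (G : Graph n) where

  Adj : Fin n → Fin n → Set
  Adj u v = adj G u v ≡ true

  data Reachable : Fin n → Fin n → Set where
    here : ∀ {u} → Reachable u u
    step : ∀ {u v w} → Adj u v → Reachable v w → Reachable u w

  Connected : Set
  Connected = ∀ u v → Reachable u v

  Chain : List (Fin n) → Set
  Chain []           = ⊤
  Chain (x ∷ [])     = ⊤
  Chain (x ∷ y ∷ xs) = Adj x y × Chain (y ∷ xs)

  Closes : List (Fin n) → Set
  Closes []       = ⊥
  Closes (x ∷ xs) with last (x ∷ xs)
  ... | just y  = Adj y x
  ... | nothing = ⊥

  IsCycle : List (Fin n) → Set
  IsCycle cs = 3 ≤ length cs × Unique cs × Chain cs × Closes cs

  Acyclic : Set
  Acyclic = ∀ cs → ¬ IsCycle cs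

  IsTree : Set
  IsTree = Connected × Acyclic

  deg : Fin n → ℕ
  deg u = foldr ℕ._+_ 0 (map (λ v → if adj G u v then 1 else 0) (Data.List.allFin n))

  edges : List (Fin n × Fin n)
  edges = concatMap (λ u → concatMap (λ v → pick u v) (Data.List.allFin n)) (Data.List.allFin n)
    where
    pick : Fin n → Fin n → List (Fin n × Fin n)
    pick u v with u <? v
    ... | yes _ = if adj G u v then (u , v) ∷ [] else []
    ... | no  _ = []

  m : ℕ
  m = length edges

  dq : Fin n → ℚ
  dq u = (+ deg u) ℚ./ 1

  ½ : ℚ
  ½ = + 1 ℚ./ 2

  sumE : (Fin n → Fin n → ℚ) → ℚ
  sumE f = foldr ℚ._+_ 0ℚ (map (λ e → f (Data.Product.proj₁ e) (Data.Product.proj₂ e)) edges)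

  module _ .{{_ : ℕ.NonZero m}} where
    minv : ℚ
    minv = + 1 ℚ./ m

    meanTerm : ℚ
    meanTerm = minv ℚ.* sumE (λ u v → ½ ℚ.* (dq u ℚ.+ dq v))

    rNum : ℚ
    rNum = minv ℚ.* sumE (λ u v → dq u ℚ.* dq v) ℚ.- meanTerm ℚ.* meanTerm

    rDen : ℚ
    rDen = minv ℚ.* sumE (λ u v → ½ ℚ.* (dq u ℚ.* dq u ℚ.+ dq v ℚ.* dq v)) ℚ.- meanTerm ℚ.* meanTerm

    assortativity : .{{_ : ℚ.NonZero rDen}} → ℚ
    assortativity = rNum ÷ rDen

  Neutral : Set
  Neutral = Σ (ℕ.NonZero m) λ nzm →
              Σ (ℚ.NonZero (rDen {{nzm}})) λ nzd →
                assortativity {{nzm}} {{nzd}} ≡ 0ℚ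

{-# OPTIONS --safe #-}
-- Let extend G add a new vertex joined to the two most recently added ones, so that iterating it
-- grows the square of a path. Once the two newest vertices have degrees 2 and 3 (two steps after any
-- start), two more steps give the newest vertices degrees 2, 3, 4, 4, and every later step only adds
-- two edges between vertices of degree 4, leaving all other degree pairs (d_u, d_v) unchanged.
-- Hence, for every F, Σ_{e_uv} F(d_u, d_v) − F(4, 4)·m is the same for all members of the family from
-- the 13-vertex one on. Starting from a suitable 9-vertex graph, that member has m = 23 and
-- Σ d_u d_v = 16m, Σ ½(d_u + d_v) = 4m, Σ ½(d_u² + d_v²) = 16m + 30; so the same holds along the whole
-- family, the numerator of r is 16 − 4² = 0 and its denominator is 30/m ≠ 0. The two newest vertices
-- and their predecessor form a triangle, so no member is a tree.
module Submission where

open import Defs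
open import Data.Nat using (ℕ; _≤_)
open import Data.Product using (Σ; _×_)
open import Relation.Nullary using (¬_)

open import Data.Bool as Bool using (Bool; true; false; if_then_else_; _∧_; _∨_)
open import Data.Bool.Properties using (∨-comm)
open import Data.Fin using (Fin; zero; suc; toℕ; #_)
open import Data.Fin.Properties using (_<?_; all?)
open import Data.Integer as ℤ using (+_)
open import Data.List using (List; []; _∷_; _++_; map; concat; concatMap; foldr; length; allFin; tabulate)
open import Data.List.Properties using (map-tabulate; map-∘; map-cong; length-map; concatMap-cong; map-concatMap)
open import Data.List.Relation.Unary.All using ([]; _∷_)
open import Data.List.Relation.Unary.AllPairs using ([]; _∷_)
open import Data.List.Relation.Unary.Unique.Propositional using (Unique)
open import Data.Nat as ℕ using (s≤s; z≤n; _≡ᵇ_; _≤ᵇ_)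
open import Data.Nat.Properties using (m+[n∸m]≡n)
open import Data.Product as Product using (_,_; uncurry)
open import Data.Rational as ℚ using (ℚ; 0ℚ; 1ℚ; toℚᵘ)
open import Data.Rational.Properties
  using (toℚᵘ-injective; toℚᵘ-fromℚᵘ; toℚᵘ-homo-+; toℚᵘ-homo-*; +-identityˡ; +-identityʳ; *-zeroˡ; *-zeroʳ;
         pos*pos⇒pos; pos⇒nonZero; normalize-pos)
import Data.Rational.Unnormalised as ℚᵘ
import Data.Rational.Unnormalised.Properties as ℚᵘ
import Data.Integer.Solver as ℤ-Solver
import Data.Rational.Solver as ℚ-Solver
open import Data.Unit using (tt)
open import Function using (_∘_; id)
open import Relation.Binary.PropositionalEquality
  using (_≡_; refl; trans; cong; cong₂; subst; module ≡-Reasoning)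
import Relation.Binary.PropositionalEquality as ≡
open import Relation.Nullary using (yes; no; does)
open import Relation.Nullary.Decidable using (dec-true; dec-false; toWitness)

private variable
  A B : Set
  n : ℕ

foldr-tabulate-neutral : (f : A → B → B) (e : B) (g : Fin n → A) →
                         (∀ i b → f (g i) b ≡ b) → foldr f e (tabulate g) ≡ e
foldr-tabulate-neutral {n = ℕ.zero}  f e g noop = refl
foldr-tabulate-neutral {n = ℕ.suc n} f e g noop =
  trans (noop zero _) (foldr-tabulate-neutral f e (g ∘ suc) (noop ∘ suc))

map-allFin-suc : (f : Fin (ℕ.suc n) → A) → map f (allFin (ℕ.suc n)) ≡ f zero ∷ map (f ∘ suc) (allFin n)
map-allFin-suc f = cong (f zero ∷_) (trans (map-tabulate suc f) (≡.sym (map-tabulate id (f ∘ suc))))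

concatMap-allFin-suc : (f : Fin (ℕ.suc n) → List A) →
                       concatMap f (allFin (ℕ.suc n)) ≡ f zero ++ concatMap (f ∘ suc) (allFin n)
concatMap-allFin-suc f = cong concat (map-allFin-suc f)

-- Extending a graph

recent : Fin n → Bool
recent zero          = true
recent (suc zero)    = true
recent (suc (suc _)) = false

-- The new vertex is 0; it is joined to the old vertices 0 and 1, which become 1 and 2.
extendAdj : (Fin n → Fin n → Bool) → Fin (ℕ.suc n) → Fin (ℕ.suc n) → Bool
extendAdj a zero    zero    = false
extendAdj a zero    (suc v) = recent v
extendAdj a (suc u) zero    = recent u
extendAdj a (suc u) (suc v) = a u v

extend : Graph n → Graph (ℕ.suc n)
extend G = record { adj = extendAdj (adj G) ; sym = extend-sym ; irrefl = extend-irrefl }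
  where
  extend-sym : ∀ u v → extendAdj (adj G) u v ≡ extendAdj (adj G) v u
  extend-sym zero    zero    = refl
  extend-sym zero    (suc v) = refl
  extend-sym (suc u) zero    = refl
  extend-sym (suc u) (suc v) = Graph.sym G u v

  extend-irrefl : ∀ u → extendAdj (adj G) u u ≡ false
  extend-irrefl zero    = refl
  extend-irrefl (suc u) = Graph.irrefl G u

edgeAt : (Fin n → Fin n → Bool) → Fin n → Fin n → List (Fin n × Fin n)
edgeAt a u v = if does (u <? v) then (if a u v then (u , v) ∷ [] else []) else []

edgesOf : (Fin n → Fin n → Bool) → List (Fin n × Fin n)
edgesOf {n} a = concatMap (λ u → concatMap (edgeAt a u) (allFin n)) (allFin n)

mutual
  edges≡edgesOf : (G : Graph n) → edges G ≡ edgesOf (adj G)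
  edges≡edgesOf {n} G = concatMap-cong (λ u → concatMap-cong (pick≡edgeAt G u) (allFin n)) (allFin n)

  -- `edges` selects its pairs with a local `with`-function, which can only be named through
  -- unification: hence the `_` and the mutual block.
  pick≡edgeAt : (G : Graph n) (u v : Fin n) → _ ≡ edgeAt (adj G) u v
  pick≡edgeAt G u v with u <? v
  ... | yes u<v rewrite dec-true  (u <? v) u<v = refl
  ... | no  u≮v rewrite dec-false (u <? v) u≮v = refl

sucPair : Fin n × Fin n → Fin (ℕ.suc n) × Fin (ℕ.suc n)
sucPair = Product.map suc suc

edgeAt-extend-suc : (a : Fin n → Fin n → Bool) (u v : Fin n) →
                    edgeAt (extendAdj a) (suc u) (suc v) ≡ map sucPair (edgeAt a u v)
edgeAt-extend-suc a u v with does (u <? v) | a u v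
... | true  | true  = refl
... | true  | false = refl
... | false | _     = refl

edgesOf-extend : (a : Fin (2 ℕ.+ n) → Fin (2 ℕ.+ n) → Bool) →
                 edgesOf (extendAdj a) ≡ (zero , suc zero) ∷ (zero , suc (suc zero)) ∷ map sucPair (edgesOf a)
edgesOf-extend {n} a = begin
  edgesOf (extendAdj a)                                ≡⟨ concatMap-allFin-suc row ⟩
  row zero ++ concatMap (row ∘ suc) (allFin (2 ℕ.+ n)) ≡⟨ cong₂ _++_ row-zero (concatMap-cong row-suc (allFin _)) ⟩
  first ++ concatMap (map sucPair ∘ oldRow) (allFin _) ≡⟨ cong (first ++_) (map-concatMap sucPair oldRow (allFin _)) ⟨
  first ++ map sucPair (edgesOf a)                     ∎
  where
  open ≡-Reasoning
  row : Fin (3 ℕ.+ n) → List (Fin (3 ℕ.+ n) × Fin (3 ℕ.+ n))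
  row u = concatMap (edgeAt (extendAdj a) u) (allFin (3 ℕ.+ n))
  oldRow : Fin (2 ℕ.+ n) → List (Fin (2 ℕ.+ n) × Fin (2 ℕ.+ n))
  oldRow u = concatMap (edgeAt a u) (allFin (2 ℕ.+ n))
  first : List (Fin (3 ℕ.+ n) × Fin (3 ℕ.+ n))
  first = (zero , suc zero) ∷ (zero , suc (suc zero)) ∷ []

  row-zero : row zero ≡ first
  row-zero = cong (first ++_) (trans (cong concat (map-tabulate suc³ (edgeAt (extendAdj a) zero)))
                                      (foldr-tabulate-neutral _++_ [] (edgeAt (extendAdj a) zero ∘ suc³) (λ _ _ → refl)))
    where
    suc³ : Fin n → Fin (3 ℕ.+ n)
    suc³ i = suc (suc (suc i))

  row-suc : ∀ u → row (suc u) ≡ map sucPair (oldRow u)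
  row-suc u = begin
    row (suc u)                                                      ≡⟨ concatMap-allFin-suc (edgeAt (extendAdj a) (suc u)) ⟩
    concatMap (edgeAt (extendAdj a) (suc u) ∘ suc) (allFin (2 ℕ.+ n)) ≡⟨ concatMap-cong (edgeAt-extend-suc a u) (allFin (2 ℕ.+ n)) ⟩
    concatMap (map sucPair ∘ edgeAt a u) (allFin (2 ℕ.+ n))           ≡⟨ map-concatMap sucPair (edgeAt a u) (allFin (2 ℕ.+ n)) ⟨
    map sucPair (oldRow u)                                           ∎

edges-extend : (G : Graph (2 ℕ.+ n)) →
               edges (extend G) ≡ (zero , suc zero) ∷ (zero , suc (suc zero)) ∷ map sucPair (edges G)
edges-extend G = begin
  edges (extend G)                      ≡⟨ edges≡edgesOf (extend G) ⟩
  edgesOf (extendAdj (adj G))           ≡⟨ edgesOf-extend (adj G) ⟩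
  _ ∷ _ ∷ map sucPair (edgesOf (adj G)) ≡⟨ cong (λ es → _ ∷ _ ∷ map sucPair es) (edges≡edgesOf G) ⟨
  _ ∷ _ ∷ map sucPair (edges G)         ∎
  where open ≡-Reasoning

m-extend : (G : Graph (2 ℕ.+ n)) → m (extend G) ≡ 2 ℕ.+ m G
m-extend G = trans (cong length (edges-extend G)) (cong (2 ℕ.+_) (length-map sucPair (edges G)))

deg-extend-zero : (G : Graph (2 ℕ.+ n)) → deg (extend G) zero ≡ 2
deg-extend-zero {n} G = cong (2 ℕ.+_) (trans (cong (foldr ℕ._+_ 0) (map-tabulate suc³ indicator))
                                             (foldr-tabulate-neutral ℕ._+_ 0 (indicator ∘ suc³) (λ _ _ → refl)))
  where
  suc³ : Fin n → Fin (3 ℕ.+ n)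
  suc³ i = suc (suc (suc i))
  indicator : Fin (3 ℕ.+ n) → ℕ
  indicator v = if adj (extend G) zero v then 1 else 0

deg-extend-suc : (G : Graph n) (u : Fin n) → deg (extend G) (suc u) ≡ (if recent u then 1 else 0) ℕ.+ deg G u
deg-extend-suc G u = cong (foldr ℕ._+_ 0) (map-allFin-suc (λ v → if adj (extend G) (suc u) v then 1 else 0))

deg-extend-one : (G : Graph (ℕ.suc n)) → deg G zero ≡ 2 → deg (extend G) (suc zero) ≡ 3
deg-extend-one G d₀ = trans (deg-extend-suc G zero) (cong ℕ.suc d₀)

deg-extend-two : (G : Graph (2 ℕ.+ n)) → deg G (suc zero) ≡ 3 → deg (extend G) (suc (suc zero)) ≡ 4
deg-extend-two G d₁ = trans (deg-extend-suc G (suc zero)) (cong ℕ.suc d₁)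

deg-extend-shift : (G : Graph (2 ℕ.+ n)) (u : Fin n) →
                   deg (extend G) (suc (suc (suc u))) ≡ deg G (suc (suc u))
deg-extend-shift G u = deg-extend-suc G (suc (suc u))

deg-extend²-one : (G : Graph (2 ℕ.+ n)) → deg (extend (extend G)) (suc zero) ≡ 3
deg-extend²-one G = deg-extend-one (extend G) (deg-extend-zero G)

deg-extend²-two : (G : Graph (2 ℕ.+ n)) → deg G zero ≡ 2 → deg (extend (extend G)) (suc (suc zero)) ≡ 4
deg-extend²-two G d₀ = deg-extend-two (extend G) (deg-extend-one G d₀)

deg-extend²-three : (G : Graph (2 ℕ.+ n)) → deg G (suc zero) ≡ 3 →
                    deg (extend (extend G)) (suc (suc (suc zero))) ≡ 4
deg-extend²-three G d₁ = trans (deg-extend-shift (extend G) zero) (deg-extend-two G d₁)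

-- Degree pairs and edge sums

degPairsBy : (Fin n → ℕ) → List (Fin n × Fin n) → List (ℕ × ℕ)
degPairsBy d = map (Product.map d d)

degPairs : Graph n → List (ℕ × ℕ)
degPairs G = degPairsBy (deg G) (edges G)

newEdgePairs : (Fin (3 ℕ.+ n) → ℕ) → List (ℕ × ℕ)
newEdgePairs d = (d zero , d (suc zero)) ∷ (d zero , d (suc (suc zero))) ∷ []

newEdgePairs-≡ : (d : Fin (3 ℕ.+ n) → ℕ) {a b c : ℕ} →
                 d zero ≡ a → d (suc zero) ≡ b → d (suc (suc zero)) ≡ c →
                 newEdgePairs d ≡ (a , b) ∷ (a , c) ∷ []
newEdgePairs-≡ d refl refl refl = refl

degPairsBy-extend : (G : Graph (2 ℕ.+ n)) (d : Fin (3 ℕ.+ n) → ℕ) →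
                    degPairsBy d (edges (extend G)) ≡ newEdgePairs d ++ degPairsBy (d ∘ suc) (edges G)
degPairsBy-extend G d = trans (cong (degPairsBy d) (edges-extend G))
                              (cong (newEdgePairs d ++_) (≡.sym (map-∘ (edges G))))

degPairsBy-extend² : (G : Graph (2 ℕ.+ n)) (d : Fin (4 ℕ.+ n) → ℕ) →
                     degPairsBy d (edges (extend (extend G))) ≡
                     newEdgePairs d ++ newEdgePairs (d ∘ suc) ++ degPairsBy (d ∘ suc ∘ suc) (edges G)
degPairsBy-extend² G d = trans (degPairsBy-extend (extend G) d)
                               (cong (newEdgePairs d ++_) (degPairsBy-extend G (d ∘ suc)))

degPairs-extend² : (X : Graph (2 ℕ.+ n)) → deg X zero ≡ 2 → deg X (suc zero) ≡ 3 →
                   degPairs (extend (extend X)) ≡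
                   (2 , 3) ∷ (2 , 4) ∷ (3 , 4) ∷ (3 , 4) ∷ degPairsBy (deg (extend (extend X)) ∘ suc ∘ suc) (edges X)
degPairs-extend² {n} X d₀ d₁ =
  trans (degPairsBy-extend² X D)
        (cong₂ _++_ (newEdgePairs-≡ D (deg-extend-zero (extend X)) (deg-extend²-one X) (deg-extend²-two X d₀))
                    (cong₂ _++_ (newEdgePairs-≡ (D ∘ suc) (deg-extend²-one X) (deg-extend²-two X d₀) (deg-extend²-three X d₁))
                                refl))
  where
  D : Fin (4 ℕ.+ n) → ℕ
  D = deg (extend (extend X))

degPairs-extend³ : (X : Graph (2 ℕ.+ n)) → deg X zero ≡ 2 → deg X (suc zero) ≡ 3 →
                   degPairs (extend (extend (extend X))) ≡
                   (2 , 3) ∷ (2 , 4) ∷ (3 , 4) ∷ (3 , 4) ∷ (4 , 4) ∷ (4 , 4) ∷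
                   degPairsBy (deg (extend (extend X)) ∘ suc ∘ suc) (edges X)
degPairs-extend³ {n} X d₀ d₁ =
  trans (degPairs-extend² (extend X) (deg-extend-zero X) (deg-extend-one X d₀))
        (cong (heads ++_) (trans (degPairsBy-extend X (D ∘ suc ∘ suc))
                                 (cong₂ _++_ (newEdgePairs-≡ (D ∘ suc ∘ suc) D2 D3 D4)
                                             (map-cong (λ (u , v) → cong₂ _,_ (shift u) (shift v)) (edges X)))))
  where
  heads : List (ℕ × ℕ)
  heads = (2 , 3) ∷ (2 , 4) ∷ (3 , 4) ∷ (3 , 4) ∷ []
  D : Fin (5 ℕ.+ n) → ℕ
  D = deg (extend (extend (extend X)))
  shift : ∀ u → D (suc (suc (suc u))) ≡ deg (extend (extend X)) (suc (suc u))
  shift = deg-extend-shift (extend (extend X))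
  D2 : D (suc (suc zero)) ≡ 4
  D2 = deg-extend²-two (extend X) (deg-extend-zero X)
  D3 : D (suc (suc (suc zero))) ≡ 4
  D3 = trans (shift zero) (deg-extend²-two X d₀)
  D4 : D (suc (suc (suc (suc zero)))) ≡ 4
  D4 = trans (shift (suc zero)) (deg-extend²-three X d₁)

sumPairs : (ℕ → ℕ → ℚ) → List (ℕ × ℕ) → ℚ
sumPairs F ps = foldr ℚ._+_ 0ℚ (map (uncurry F) ps)

edgeSum : Graph n → (ℕ → ℕ → ℚ) → ℚ
edgeSum G F = sumE G (λ u v → F (deg G u) (deg G v))

edgeSum≡sumPairs : (G : Graph n) (F : ℕ → ℕ → ℚ) → edgeSum G F ≡ sumPairs F (degPairs G)
edgeSum≡sumPairs G F = cong (foldr ℚ._+_ 0ℚ) (map-∘ (edges G))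

edgeSum-extend³ : (X : Graph (2 ℕ.+ n)) → deg X zero ≡ 2 → deg X (suc zero) ≡ 3 →
                  (F : ℕ → ℕ → ℚ) →
                  edgeSum (extend (extend (extend X))) F ≡ F 4 4 ℚ.+ (F 4 4 ℚ.+ edgeSum (extend (extend X)) F)
edgeSum-extend³ {n} X d₀ d₁ F = begin
  edgeSum X₃ F
    ≡⟨ trans (edgeSum≡sumPairs X₃ F) (cong (sumPairs F) (degPairs-extend³ X d₀ d₁)) ⟩
  F 2 3 ℚ.+ (F 2 4 ℚ.+ (F 3 4 ℚ.+ (F 3 4 ℚ.+ (F 4 4 ℚ.+ (F 4 4 ℚ.+ sumPairs F old)))))
    ≡⟨ solve 6 (λ a b c d e t → a :+ (b :+ (c :+ (d :+ (e :+ (e :+ t))))) :=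
                                e :+ (e :+ (a :+ (b :+ (c :+ (d :+ t)))))) refl
               (F 2 3) (F 2 4) (F 3 4) (F 3 4) (F 4 4) (sumPairs F old) ⟩
  F 4 4 ℚ.+ (F 4 4 ℚ.+ (F 2 3 ℚ.+ (F 2 4 ℚ.+ (F 3 4 ℚ.+ (F 3 4 ℚ.+ sumPairs F old)))))
    ≡⟨ cong (λ s → F 4 4 ℚ.+ (F 4 4 ℚ.+ s)) (trans (edgeSum≡sumPairs X₂ F) (cong (sumPairs F) (degPairs-extend² X d₀ d₁))) ⟨
  F 4 4 ℚ.+ (F 4 4 ℚ.+ edgeSum X₂ F)
    ∎
  where
  open ≡-Reasoning
  open ℚ-Solver.+-*-Solver
  X₂ : Graph (4 ℕ.+ n)
  X₂ = extend (extend X)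
  X₃ : Graph (5 ℕ.+ n)
  X₃ = extend X₂
  old : List (ℕ × ℕ)
  old = degPairsBy (deg X₂ ∘ suc ∘ suc) (edges X)

-- Neutrality

toℚ : ℕ → ℚ
toℚ k = + k ℚ./ 1

toℚ-suc : ∀ k → toℚ (ℕ.suc k) ≡ 1ℚ ℚ.+ toℚ k
toℚ-suc k = toℚᵘ-injective (begin
  toℚᵘ (toℚ (ℕ.suc k))                       ≈⟨ toℚᵘ-fromℚᵘ (ℚᵘ.mkℚᵘ (+ ℕ.suc k) 0) ⟩
  ℚᵘ.mkℚᵘ (+ ℕ.suc k) 0                      ≈⟨ ℚᵘ.*≡* (identity (+ k)) ⟩
  ℚᵘ.mkℚᵘ (+ 1) 0 ℚᵘ.+ ℚᵘ.mkℚᵘ (+ k) 0       ≈⟨ ℚᵘ.+-congʳ (ℚᵘ.mkℚᵘ (+ 1) 0) (toℚᵘ-fromℚᵘ (ℚᵘ.mkℚᵘ (+ k) 0)) ⟨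
  toℚᵘ 1ℚ ℚᵘ.+ toℚᵘ (toℚ k)                  ≈⟨ toℚᵘ-homo-+ 1ℚ (toℚ k) ⟨
  toℚᵘ (1ℚ ℚ.+ toℚ k)                        ∎)
  where
  open ℚᵘ.≃-Reasoning
  open ℤ-Solver.+-*-Solver
  identity : ∀ x → (+ 1 ℤ.+ x) ℤ.* (+ 1 ℤ.* + 1) ≡ (+ 1 ℤ.* + 1 ℤ.+ x ℤ.* + 1) ℤ.* + 1
  identity = solve 1 (λ x → (con (+ 1) :+ x) :* (con (+ 1) :* con (+ 1)) :=
                            (con (+ 1) :* con (+ 1) :+ x :* con (+ 1)) :* con (+ 1)) refl

1/k*k≡1 : ∀ k .{{_ : ℕ.NonZero k}} → (+ 1 ℚ./ k) ℚ.* toℚ k ≡ 1ℚ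
1/k*k≡1 (ℕ.suc k) = toℚᵘ-injective (begin
  toℚᵘ ((+ 1 ℚ./ ℕ.suc k) ℚ.* toℚ (ℕ.suc k))             ≈⟨ toℚᵘ-homo-* (+ 1 ℚ./ ℕ.suc k) (toℚ (ℕ.suc k)) ⟩
  toℚᵘ (+ 1 ℚ./ ℕ.suc k) ℚᵘ.* toℚᵘ (toℚ (ℕ.suc k))       ≈⟨ ℚᵘ.*-cong (toℚᵘ-fromℚᵘ (ℚᵘ.mkℚᵘ (+ 1) k))
                                                                      (toℚᵘ-fromℚᵘ (ℚᵘ.mkℚᵘ (+ ℕ.suc k) 0)) ⟩
  ℚᵘ.mkℚᵘ (+ 1) k ℚᵘ.* ℚᵘ.mkℚᵘ (+ ℕ.suc k) 0             ≈⟨ ℚᵘ.*≡* (identity (+ ℕ.suc k)) ⟩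
  toℚᵘ 1ℚ                                                  ∎)
  where
  open ℚᵘ.≃-Reasoning
  open ℤ-Solver.+-*-Solver
  identity : ∀ x → (+ 1 ℤ.* x) ℤ.* + 1 ≡ + 1 ℤ.* (x ℤ.* + 1)
  identity = solve 1 (λ x → (con (+ 1) :* x) :* con (+ 1) := con (+ 1) :* (x :* con (+ 1))) refl

degProduct degMean degSquareMean : ℕ → ℕ → ℚ
degProduct    a b = toℚ a ℚ.* toℚ b
degMean       a b = ℚ.½ ℚ.* (toℚ a ℚ.+ toℚ b)
degSquareMean a b = ℚ.½ ℚ.* (toℚ a ℚ.* toℚ a ℚ.+ toℚ b ℚ.* toℚ b)

neutral-criterion : (G : Graph n) {{m≢0 : ℕ.NonZero (m G)}} (a c : ℚ) .{{_ : ℚ.Positive c}} →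
                    edgeSum G degProduct    ≡ a ℚ.* a ℚ.* toℚ (m G) →
                    edgeSum G degMean       ≡ a ℚ.* toℚ (m G) →
                    edgeSum G degSquareMean ≡ a ℚ.* a ℚ.* toℚ (m G) ℚ.+ c →
                    Neutral G
neutral-criterion G {{m≢0}} a c product mean square = m≢0 , rDen≢0 , r≡0
  where
  open ≡-Reasoning
  open ℚ-Solver.+-*-Solver
  i M t : ℚ
  i = minv G
  M = toℚ (m G)
  t = i ℚ.* M

  a²t[1-t]≡0 : a ℚ.* a ℚ.* (t ℚ.* (1ℚ ℚ.- t)) ≡ 0ℚ
  a²t[1-t]≡0 = trans (cong (λ s → a ℚ.* a ℚ.* (s ℚ.* (1ℚ ℚ.- s))) (1/k*k≡1 (m G))) (*-zeroʳ (a ℚ.* a))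

  rNum≡0 : rNum G ≡ 0ℚ
  rNum≡0 = begin
    i ℚ.* edgeSum G degProduct ℚ.- (i ℚ.* edgeSum G degMean) ℚ.* (i ℚ.* edgeSum G degMean)
      ≡⟨ cong₂ (λ p q → i ℚ.* p ℚ.- (i ℚ.* q) ℚ.* (i ℚ.* q)) product mean ⟩
    i ℚ.* (a ℚ.* a ℚ.* M) ℚ.- (i ℚ.* (a ℚ.* M)) ℚ.* (i ℚ.* (a ℚ.* M))
      ≡⟨ solve 3 (λ a i M → i :* (a :* a :* M) :- (i :* (a :* M)) :* (i :* (a :* M)) :=
                            a :* a :* ((i :* M) :* (con 1ℚ :- i :* M))) refl a i M ⟩
    a ℚ.* a ℚ.* (t ℚ.* (1ℚ ℚ.- t))
      ≡⟨ a²t[1-t]≡0 ⟩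
    0ℚ ∎

  rDen≡c*i : rDen G ≡ c ℚ.* i
  rDen≡c*i = begin
    i ℚ.* edgeSum G degSquareMean ℚ.- (i ℚ.* edgeSum G degMean) ℚ.* (i ℚ.* edgeSum G degMean)
      ≡⟨ cong₂ (λ p q → i ℚ.* p ℚ.- (i ℚ.* q) ℚ.* (i ℚ.* q)) square mean ⟩
    i ℚ.* (a ℚ.* a ℚ.* M ℚ.+ c) ℚ.- (i ℚ.* (a ℚ.* M)) ℚ.* (i ℚ.* (a ℚ.* M))
      ≡⟨ solve 4 (λ a c i M → i :* (a :* a :* M :+ c) :- (i :* (a :* M)) :* (i :* (a :* M)) :=
                              a :* a :* ((i :* M) :* (con 1ℚ :- i :* M)) :+ c :* i) refl a c i M ⟩
    a ℚ.* a ℚ.* (t ℚ.* (1ℚ ℚ.- t)) ℚ.+ c ℚ.* i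
      ≡⟨ cong (ℚ._+ c ℚ.* i) a²t[1-t]≡0 ⟩
    0ℚ ℚ.+ c ℚ.* i
      ≡⟨ +-identityˡ (c ℚ.* i) ⟩
    c ℚ.* i ∎

  rDen≢0 : ℚ.NonZero (rDen G)
  rDen≢0 = subst ℚ.NonZero (≡.sym rDen≡c*i)
                 (pos⇒nonZero (c ℚ.* i) {{pos*pos⇒pos c i {{normalize-pos 1 (m G)}}}})

  r≡0 : assortativity G {{m≢0}} {{rDen≢0}} ≡ 0ℚ
  r≡0 = trans (cong (ℚ._* (ℚ.1/ rDen G) {{rDen≢0}}) rNum≡0) (*-zeroˡ ((ℚ.1/ rDen G) {{rDen≢0}}))

-- The family

-- The square of the path 0 … 7, with the chord 0–3 and a pendant vertex 8 at 3.
baseEdge : ℕ → ℕ → Bool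
baseEdge a b = (((b ≡ᵇ a ℕ.+ 1) ∨ (b ≡ᵇ a ℕ.+ 2)) ∧ (b ≤ᵇ 7)) ∨ ((a ≡ᵇ 0) ∧ (b ≡ᵇ 3)) ∨ ((a ≡ᵇ 3) ∧ (b ≡ᵇ 8))

base : Graph 9
base = record
  { adj    = λ u v → baseEdge (toℕ u) (toℕ v) ∨ baseEdge (toℕ v) (toℕ u)
  ; sym    = λ u v → ∨-comm (baseEdge (toℕ u) (toℕ v)) (baseEdge (toℕ v) (toℕ u))
  ; irrefl = toWitness {a? = all? (λ u → baseEdge (toℕ u) (toℕ u) ∨ baseEdge (toℕ u) (toℕ u) Bool.≟ false)} tt
  }

family : (k : ℕ) → Graph (9 ℕ.+ k)
family ℕ.zero    = base
family (ℕ.suc k) = extend (family k)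

-- F 4 4 ≡ a is an argument so that conversion never has to evaluate toℚ (m G) for an open member G.
edgeSum-family : (F : ℕ → ℕ → ℚ) (a c : ℚ) → F 4 4 ≡ a →
                 edgeSum (family 4) F ≡ a ℚ.* toℚ (m (family 4)) ℚ.+ c →
                 ∀ j → edgeSum (family (4 ℕ.+ j)) F ≡ a ℚ.* toℚ (m (family (4 ℕ.+ j))) ℚ.+ c
edgeSum-family F a c F44≡a initial ℕ.zero    = initial
edgeSum-family F a c F44≡a initial (ℕ.suc j) = begin
  edgeSum (extend G) F
    ≡⟨ edgeSum-extend³ (family (2 ℕ.+ j)) (deg-extend-zero (family (1 ℕ.+ j)))
                       (deg-extend-one (family (1 ℕ.+ j)) (deg-extend-zero (family j))) F ⟩
  F 4 4 ℚ.+ (F 4 4 ℚ.+ edgeSum G F)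
    ≡⟨ cong₂ (λ x s → x ℚ.+ (x ℚ.+ s)) F44≡a (edgeSum-family F a c F44≡a initial j) ⟩
  a ℚ.+ (a ℚ.+ (a ℚ.* toℚ (m G) ℚ.+ c))
    ≡⟨ solve 3 (λ a M c → a :+ (a :+ (a :* M :+ c)) := a :* (con 1ℚ :+ (con 1ℚ :+ M)) :+ c) refl a (toℚ (m G)) c ⟩
  a ℚ.* (1ℚ ℚ.+ (1ℚ ℚ.+ toℚ (m G))) ℚ.+ c
    ≡⟨ cong (λ x → a ℚ.* x ℚ.+ c) (trans (toℚ-suc (ℕ.suc (m G))) (cong (1ℚ ℚ.+_) (toℚ-suc (m G)))) ⟨
  a ℚ.* toℚ (2 ℕ.+ m G) ℚ.+ c
    ≡⟨ cong (λ k → a ℚ.* toℚ k ℚ.+ c) (m-extend G) ⟨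
  a ℚ.* toℚ (m (extend G)) ℚ.+ c ∎
  where
  open ≡-Reasoning
  open ℚ-Solver.+-*-Solver
  G : Graph (13 ℕ.+ j)
  G = family (4 ℕ.+ j)

family-neutral : ∀ j → Neutral (family (4 ℕ.+ j))
family-neutral j = neutral-criterion G four thirty
  (trans (edgeSum-family degProduct (four ℚ.* four) 0ℚ refl refl j) (+-identityʳ (four ℚ.* four ℚ.* M)))
  (trans (edgeSum-family degMean four 0ℚ refl refl j) (+-identityʳ (four ℚ.* M)))
  (edgeSum-family degSquareMean (four ℚ.* four) thirty refl refl j)
  where
  G : Graph (13 ℕ.+ j)
  G = family (4 ℕ.+ j)
  M : ℚ
  M = toℚ (m G)
  four thirty : ℚ
  four   = toℚ 4
  thirty = toℚ 30
  instance
    m≢0 : ℕ.NonZero (m G)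
    m≢0 = subst ℕ.NonZero (≡.sym (m-extend (family (3 ℕ.+ j)))) _

-- Connectivity

reachable-trans : {G : Graph n} {u v w : Fin n} → Reachable G u v → Reachable G v w → Reachable G u w
reachable-trans here        q = q
reachable-trans (step uv p) q = step uv (reachable-trans p q)

reachable-sym : {G : Graph n} {u v : Fin n} → Reachable G u v → Reachable G v u
reachable-sym         here                = here
reachable-sym {G = G} (step {u} {v} uv p) = reachable-trans (reachable-sym p) (step (trans (Graph.sym G v u) uv) here)

connected-if-reaches : (G : Graph n) (z : Fin n) → (∀ v → Reachable G v z) → Connected G
connected-if-reaches G z reach u v = reachable-trans (reach u) (reachable-sym (reach v))

reachable-extend : {G : Graph n} {u v : Fin n} → Reachable G u v → Reachable (extend G) (suc u) (suc v)
reachable-extend here        = here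
reachable-extend (step uv p) = step uv (reachable-extend p)

extend-connected : (G : Graph (ℕ.suc n)) → Connected G → Connected (extend G)
extend-connected G connected = connected-if-reaches (extend G) zero reach
  where
  reach : ∀ v → Reachable (extend G) v zero
  reach zero    = here
  reach (suc v) = reachable-trans (reachable-extend (connected v zero)) (step refl here)

base-connected : Connected base
base-connected = connected-if-reaches base zero reach
  where
  three-reaches : Reachable base (# 3) zero
  three-reaches = step refl here

  reach : ∀ v → Reachable base v zero
  reach zero                                                 = here
  reach (suc zero)                                           = step refl here
  reach (suc (suc zero))                                     = step refl here
  reach (suc (suc (suc zero)))                               = three-reaches
  reach (suc (suc (suc (suc zero))))                         = step {v = # 3} refl three-reaches
  reach (suc (suc (suc (suc (suc zero)))))                   = step {v = # 3} refl three-reaches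
  reach (suc (suc (suc (suc (suc (suc zero))))))             = step {v = # 4} refl (step {v = # 3} refl three-reaches)
  reach (suc (suc (suc (suc (suc (suc (suc zero)))))))       = step {v = # 5} refl (step {v = # 3} refl three-reaches)
  reach (suc (suc (suc (suc (suc (suc (suc (suc zero)))))))) = step {v = # 3} refl three-reaches

family-connected : ∀ k → Connected (family k)
family-connected ℕ.zero    = base-connected
family-connected (ℕ.suc k) = extend-connected (family k) (family-connected k)

extend²-not-tree : (G : Graph (ℕ.suc n)) → ¬ IsTree (extend (extend G))
extend²-not-tree G (_ , acyclic) =
  acyclic (zero ∷ suc zero ∷ suc (suc zero) ∷ [])
          (s≤s (s≤s (s≤s z≤n)) , distinct , (refl , refl , tt) , refl)
  where
  distinct : Unique (zero ∷ suc zero ∷ suc (suc zero) ∷ [])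
  distinct = ((λ ()) ∷ (λ ()) ∷ []) ∷ ((λ ()) ∷ []) ∷ [] ∷ []

theorem4 : ∀ (n : ℕ) → 13 ≤ n →
    Σ (Graph n) λ G → Connected G × ¬ IsTree G × Neutral G
theorem4 n 13≤n =
  subst (λ k → Σ (Graph k) λ G → Connected G × ¬ IsTree G × Neutral G) (m+[n∸m]≡n 13≤n)
        (family (4 ℕ.+ j) , family-connected (4 ℕ.+ j) , extend²-not-tree (family (2 ℕ.+ j)) , family-neutral j)
  where
  j : ℕ
  j = n ℕ.∸ 13
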